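{- Run the main algorithm (described in the context) on any instance. Then every job belongs to $\widetilde{S}(X)$ for at most one batch $X$ created by the algorithm.
   Context: Machine types are indexed $k=0,1,2,\dots$ with capacities $B_0<B_1<\cdots$ (positive integers) and costs $c_k=2^k$; unlimited machines of each type. Unit-length jobs $j$ arrive online with integer release time $r_j$ and integer deadline $d_j\ge r_j$, revealed at time $r_j$. A batch $X$ has a job set $J(X)$, type $t(X)$, execution time $\tau(X)$, with $|J(X)|\le B_{t(X)}$ and $r_j\le\tau(X)\le d_j$ for $j\in J(X)$. Main algorithm: maintain the set $\mathcal{X}$ of batches created so far and the set $W$ of released but not yet executed jobs. For $\tau=0,1,2,\dots$: add the jobs released at $\tau$ to $W$; while some job of $W$ has deadline $\tau$, pick one such job $j^*$ (arbitrarily), create a batch $X^*$ by the subroutine below, add it to $\mathcal{X}$ and remove $J(X^*)$ from $W$. The job $j^*$ is called the critical job of $X^*$; the other jobs of $J(X^*)$ are its non-critical jobs. Subroutine: set $k\leftarrow0$ and $I_0\leftarrow[r_{j^*},\tau]$. While $I_k$ contains the execution time of some batch of $\mathcal{X}$ of type $k$: let $X_k$ be such a batch with the latest execution time $\tau_k=\tau(X_k)$ in $I_k$, let $\tau'_k$ be the earliest release time of a job in $J(X_k)$, set $I_{k+1}\leftarrow I_k\cup[\tau'_k,\tau_k]$, and $k\leftarrow k+1$. When the loop stops, set $\widetilde{I}(X^*)\leftarrow I_k$, and let $\widetilde{S}(X^*)$ consist of $j^*$ together with, if $k>0$, all non-critical jobs of $X_{k-1}$. The batch $X^*$ has type $t(X^*)=k$,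 execution time $\tau(X^*)=\tau$, and $J(X^*)$ equal to the $\min(B_k,|W|)$ jobs of $W$ with earliest deadlines (earliest deadline first), ties broken so that $j^*\in J(X^*)$. -}

module Defs where

open import Data.Nat using (ℕ; zero; suc; _≤_; _<_; _⊓_)
open import Data.Fin using (Fin; _≟_)
open import Data.Fin.Properties using ()
open import Data.List using (List; []; _∷_; _++_; [_]; filter; length; allFin)
open import Data.List.Membership.Propositional using (_∈_; _∉_)
open import Data.List.Membership.DecPropositional using () renaming (_∈?_ to ∈?-with)
open import Data.List.Relation.Unary.Unique.Propositional using (Unique)
open import Data.Maybe using (Maybe; nothing; just)
open import Data.Product using (_×_; Σ)
open import Data.Sum using (_⊎_)
open import Relation.Binary.PropositionalEquality using (_≡_)
open import Relation.Nullary using (¬_; ¬?)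
import Data.Nat as N

record Batch (n : ℕ) : Set where
  constructor mkBatch
  field
    jobs   : List (Fin n)
    type   : ℕ
    time   : ℕ
    crit   : Fin n
    stilde : List (Fin n)

open Batch public

nonCritical : ∀ {n} → Maybe (Batch n) → List (Fin n)
nonCritical nothing  = []
nonCritical (just X) = filter (λ j → ¬? (j ≟ crit X)) (jobs X)

module Algorithm {n : ℕ} (B : ℕ → ℕ) (r d : Fin n → ℕ) where

  released : ℕ → List (Fin n)
  released τ = filter (λ j → r j N.≟ τ) (allFin n)

  EarliestRelease : Batch n → ℕ → Set
  EarliestRelease X τ' =
    Σ (Fin n) (λ j → j ∈ jobs X × r j ≡ τ') × (∀ {j} → j ∈ jobs X → τ' ≤ r j)

  -- The subroutine's while-loop, as a relation.
  -- Loop 𝒳 I k p kf pf : starting with current interval I (a set of times,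
  -- given as a predicate), current index k and previously chosen batch p
  -- (p = just X_{k-1}, or nothing if k = 0), the loop may terminate with
  -- final index kf and last chosen batch pf.
  data Loop (𝒳 : List (Batch n)) :
       (ℕ → Set) → ℕ → Maybe (Batch n) → ℕ → Maybe (Batch n) → Set₁ where
    stop : ∀ {I k p} →
           (∀ {X} → X ∈ 𝒳 → type X ≡ k → ¬ I (time X)) →
           Loop 𝒳 I k p k p
    step : ∀ {I k p kf pf} (X : Batch n) (τ' : ℕ) →
           X ∈ 𝒳 → type X ≡ k → I (time X) →
           (∀ {Y} → Y ∈ 𝒳 → type Y ≡ k → I (time Y) → time Y ≤ time X) →
           EarliestRelease X τ' →
           Loop 𝒳 (λ t → I t ⊎ (τ' ≤ t × t ≤ time X)) (suc k) (just X) kf pf →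
           Loop 𝒳 I k p kf pf

  EDF : List (Fin n) → Fin n → ℕ → List (Fin n) → Set
  EDF W j* k J =
    Unique J × (∀ {j} → j ∈ J → j ∈ W) × length J ≡ B k ⊓ length W × j* ∈ J ×
    (∀ {j j'} → j ∈ J → j' ∈ W → j' ∉ J → d j ≤ d j')

  remove : List (Fin n) → List (Fin n) → List (Fin n)
  remove J W = filter (λ j → ¬? (∈?-with _≟_ j J)) W

  -- Reach τ W 𝒳 : some run of the main algorithm reaches a point in the
  -- while-loop of time step τ (jobs released at τ already added to W)
  -- with waiting set W and created batches 𝒳 (in creation order).
  data Reach : ℕ → List (Fin n) → List (Batch n) → Set₁ where
    init    : Reach 0 (released 0) []
    create  : ∀ {τ W 𝒳 k p J} (j* : Fin n) →
              Reach τ W 𝒳 → j* ∈ W → d j* ≡ τ →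
              Loop 𝒳 (λ t → r j* ≤ t × t ≤ τ) 0 nothing k p →
              EDF W j* k J →
              Reach τ (remove J W) (𝒳 ++ [ mkBatch J k τ j* (j* ∷ nonCritical p) ])
    advance : ∀ {τ W 𝒳} →
              Reach τ W 𝒳 → (∀ {j} → j ∈ W → ¬ (d j ≡ τ)) →
              Reach (suc τ) (W ++ released (suc τ)) 𝒳

-- A job lies in S~(X) either as the critical job of X or as a non-critical job of the batch
-- X' = X_{k-1} found last by the subroutine, where t(X) = t(X') + 1 and τ(X') ≤ τ(X).
-- A critical job is still waiting when its batch is created, so it is in no earlier batch
-- and hence in no earlier S~. Since batches have disjoint job sets, a non-critical job j of
-- X' lies in S~ of an earlier batch X only as a non-critical job of the same X'; then X has
-- the type t(X') + 1 at which the subroutine stopped, and τ(X) lies between τ(X') and the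
-- current time, inside the final interval I_k.  That contradicts the stopping condition.
module Submission where

open import Defs
open import Data.Nat as ℕ using (ℕ; suc; _≤_; _<_; _≤?_)
open import Data.Nat.Properties using (≤-refl; ≤-trans; ≤-reflexive; <⇒≤; ≰⇒>; m≤n⇒m≤1+n; n≮n)
open import Data.Fin using (Fin; zero; suc)
open import Data.Fin.Properties using (_≟_)
open import Data.List using (List; []; _∷_; _++_; [_]; length; lookup; allFin)
open import Data.List.Membership.Propositional using (_∈_; _∉_)
open import Data.List.Membership.Propositional.Properties using (∈-++⁻; ∈-++⁺ˡ; ∈-filter⁻; ∈-lookup)
open import Data.List.Membership.DecPropositional using () renaming (_∈?_ to ∈?-with)
open import Data.List.Relation.Unary.Any using (here; there)
open import Data.List.Relation.Unary.All as All using (All; []; _∷_)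
open import Data.List.Relation.Unary.All.Properties using (∷ʳ⁺)
open import Data.List.Relation.Unary.AllPairs using (AllPairs; []; _∷_)
import Data.List.Relation.Unary.AllPairs.Properties as AllPairs
open import Data.List.Relation.Binary.Disjoint.Propositional using (Disjoint)
open import Data.Maybe using (Maybe; nothing; just)
open import Data.Maybe.Relation.Unary.All as Maybe using (just; nothing)
open import Data.Product using (Σ; _×_; _,_; proj₁; proj₂)
open import Data.Sum using (_⊎_; inj₁; inj₂)
open import Data.Empty using (⊥; ⊥-elim)
open import Function using (_on_)
open import Relation.Nullary using (¬_; ¬?; yes; no)
open import Relation.Binary.PropositionalEquality using (_≡_; refl; cong; subst)

module _ {A B : Set} {f : A → List B} where

  disjoint-∈-unique : ∀ {xs x y v} → AllPairs (Disjoint on f) xs →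
                      x ∈ xs → y ∈ xs → v ∈ f x → v ∈ f y → x ≡ y
  disjoint-∈-unique (_ ∷ _)     (here refl) (here refl) _   _   = refl
  disjoint-∈-unique (px ∷ _)    (here refl) (there y∈)  v∈x v∈y = ⊥-elim (All.lookup px y∈ (v∈x , v∈y))
  disjoint-∈-unique (px ∷ _)    (there x∈)  (here refl) v∈x v∈y = ⊥-elim (All.lookup px x∈ (v∈y , v∈x))
  disjoint-∈-unique (_ ∷ pairs) (there x∈)  (there y∈)  v∈x v∈y = disjoint-∈-unique pairs x∈ y∈ v∈x v∈y

  disjoint-lookup-unique : ∀ {xs v} → AllPairs (Disjoint on f) xs → (i k : Fin (length xs)) →
                           v ∈ f (lookup xs i) → v ∈ f (lookup xs k) → i ≡ k
  disjoint-lookup-unique (_ ∷ _)     zero    zero    _   _   = refl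
  disjoint-lookup-unique (px ∷ _)    zero    (suc k) v∈i v∈k = ⊥-elim (All.lookup px (∈-lookup k) (v∈i , v∈k))
  disjoint-lookup-unique (px ∷ _)    (suc i) zero    v∈i v∈k = ⊥-elim (All.lookup px (∈-lookup i) (v∈k , v∈i))
  disjoint-lookup-unique (_ ∷ pairs) (suc i) (suc k) v∈i v∈k = cong suc (disjoint-lookup-unique pairs i k v∈i v∈k)

  disjoint-∷ʳ : ∀ {xs z} → AllPairs (Disjoint on f) xs → All (λ x → Disjoint (f x) (f z)) xs →
                AllPairs (Disjoint on f) (xs ++ [ z ])
  disjoint-∷ʳ pairs fresh = AllPairs.++⁺ pairs ([] ∷ []) (All.map (_∷ []) fresh)

Convex : (ℕ → Set) → Set
Convex I = ∀ {a b c} → a ≤ b → b ≤ c → I a → I c → I b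

interval-convex : ∀ {lo hi} → Convex (λ s → lo ≤ s × s ≤ hi)
interval-convex a≤b b≤c (lo≤a , _) (_ , c≤hi) = ≤-trans lo≤a a≤b , ≤-trans b≤c c≤hi

convex-∪-interval : ∀ {I lo hi} → Convex I → I hi → Convex (λ s → I s ⊎ (lo ≤ s × s ≤ hi))
convex-∪-interval convex Ihi a≤b b≤c (inj₁ Ia) (inj₁ Ic) = inj₁ (convex a≤b b≤c Ia Ic)
convex-∪-interval convex Ihi a≤b b≤c (inj₁ Ia) (inj₂ (_ , c≤hi)) = inj₁ (convex a≤b (≤-trans b≤c c≤hi) Ia Ihi)
convex-∪-interval convex Ihi a≤b b≤c (inj₂ a∈) (inj₂ c∈) = inj₂ (interval-convex a≤b b≤c a∈ c∈)
convex-∪-interval {hi = hi} convex Ihi {b = b} a≤b b≤c (inj₂ (lo≤a , _)) (inj₁ Ic) with b ≤? hi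
... | yes b≤hi = inj₂ (≤-trans lo≤a a≤b , b≤hi)
... | no  b≰hi = inj₁ (convex (<⇒≤ (≰⇒> b≰hi)) b≤c Ihi Ic)

∈-nonCritical⁻ : ∀ {n} (Z : Batch n) {j} → j ∈ nonCritical (just Z) → j ∈ jobs Z × ¬ j ≡ crit Z
∈-nonCritical⁻ Z = ∈-filter⁻ (λ j → ¬? (j ≟ crit Z))

module _ {n : ℕ} (B : ℕ → ℕ) (r d : Fin n → ℕ) where
  open Algorithm B r d

  ∈-released⁻ : ∀ {τ j} → j ∈ released τ → r j ≡ τ
  ∈-released⁻ {τ} j∈ = proj₂ (∈-filter⁻ (λ j → r j ℕ.≟ τ) {xs = allFin n} j∈)

  loop-chosen : ∀ {𝒳 I k p kf pf} → Loop 𝒳 I k p kf pf →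
                Maybe.All (λ Z → Z ∈ 𝒳 × k ≡ suc (type Z)) p →
                Maybe.All (λ Z → Z ∈ 𝒳 × kf ≡ suc (type Z)) pf
  loop-chosen (stop _)                     chosen = chosen
  loop-chosen (step X _ X∈ refl _ _ _ rest) _      = loop-chosen rest (just (X∈ , refl))

  -- The final interval contains τ(X_{k-1}) and τ, hence everything between them.
  loop-exit-avoids : ∀ {𝒳 I k p kf Z τ} → Loop 𝒳 I k p kf (just Z) → Convex I → I τ →
                     Maybe.All (λ Z' → I (time Z')) p →
                     ∀ {X} → X ∈ 𝒳 → type X ≡ kf → time Z ≤ time X → time X ≤ τ → ⊥
  loop-exit-avoids (stop avoids) convex Iτ (just IZ) X∈ ty Z≤X X≤τ =
    avoids X∈ ty (convex Z≤X X≤τ IZ Iτ)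
  loop-exit-avoids (step _ _ _ _ IX _ _ rest) convex Iτ _ =
    loop-exit-avoids rest (convex-∪-interval convex IX) (inj₁ Iτ) (just (inj₁ IX))

  -- Z is the batch X_{k-1} whose non-critical jobs enter S~(X).
  Predecessor : List (Batch n) → Batch n → Batch n → Set
  Predecessor 𝒳 X Z = Z ∈ 𝒳 × type X ≡ suc (type Z) × time Z ≤ time X

  record StildeShape (𝒳 : List (Batch n)) (X : Batch n) : Set where
    constructor stildeShape
    field
      previous    : Maybe (Batch n)
      stilde-≡    : stilde X ≡ crit X ∷ nonCritical previous
      predecessor : Maybe.All (Predecessor 𝒳 X) previous

  ∈-stilde⁻ : ∀ {𝒳 X j} → StildeShape 𝒳 X → j ∈ stilde X →
              j ≡ crit X ⊎ Σ (Batch n) λ Z → Predecessor 𝒳 X Z × j ∈ nonCritical (just Z)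
  ∈-stilde⁻ {𝒳} {X} {j} (stildeShape p eq pred) j∈ = from-∷ pred (subst (j ∈_) eq j∈)
    where
    from-∷ : ∀ {p c} → Maybe.All (Predecessor 𝒳 X) p → j ∈ c ∷ nonCritical p →
             j ≡ c ⊎ Σ (Batch n) λ Z → Predecessor 𝒳 X Z × j ∈ nonCritical (just Z)
    from-∷ _         (here j≡c)   = inj₁ j≡c
    from-∷ (just pZ) (there j∈nc) = inj₂ (_ , pZ , j∈nc)

  record Invariant (τ : ℕ) (W : List (Fin n)) (𝒳 : List (Batch n)) : Set where
    field
      executed            : All (λ X → time X ≤ τ) 𝒳
      scheduled-released  : All (λ X → All (λ j → r j ≤ τ) (jobs X)) 𝒳
      waiting-released    : All (λ j → r j ≤ τ) W
      waiting-unscheduled : All (λ X → Disjoint (jobs X) W) 𝒳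
      critical-scheduled  : All (λ X → crit X ∈ jobs X) 𝒳
      jobs-disjoint       : AllPairs (Disjoint on jobs) 𝒳
      stilde-shape        : All (StildeShape 𝒳) 𝒳
      stilde-disjoint     : AllPairs (Disjoint on stilde) 𝒳

  module _ {τ W 𝒳} (inv : Invariant τ W 𝒳) where
    open Invariant inv

    waiting-∉-stilde : ∀ {j X} → j ∈ W → X ∈ 𝒳 → j ∉ stilde X
    waiting-∉-stilde j∈W X∈ j∈S with ∈-stilde⁻ (All.lookup stilde-shape X∈) j∈S
    ... | inj₁ refl = All.lookup waiting-unscheduled X∈ (All.lookup critical-scheduled X∈ , j∈W)
    ... | inj₂ (Z , (Z∈ , _) , j∈nc) =
      All.lookup waiting-unscheduled Z∈ (proj₁ (∈-nonCritical⁻ Z j∈nc) , j∈W)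

    nonCritical-∉-stilde : ∀ {j* kf Z j X} → j* ∈ W →
                           Loop 𝒳 (λ t → r j* ≤ t × t ≤ τ) 0 nothing kf (just Z) →
                           j ∈ nonCritical (just Z) → X ∈ 𝒳 → j ∉ stilde X
    nonCritical-∉-stilde {Z = Z} j*∈W loop j∈nc X∈ j∈S
      with loop-chosen loop nothing | ∈-nonCritical⁻ Z j∈nc | ∈-stilde⁻ (All.lookup stilde-shape X∈) j∈S
    ... | just (Z∈ , _) | j∈Z , j≢crit | inj₁ refl =
      j≢crit (cong crit (disjoint-∈-unique jobs-disjoint X∈ Z∈ (All.lookup critical-scheduled X∈) j∈Z))
    ... | just (Z∈ , refl) | j∈Z , _ | inj₂ (Z' , (Z'∈ , ty , Z≤X) , j∈nc')
      with disjoint-∈-unique jobs-disjoint Z'∈ Z∈ (proj₁ (∈-nonCritical⁻ Z' j∈nc')) j∈Z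
    ... | refl = loop-exit-avoids loop interval-convex (All.lookup waiting-released j*∈W , ≤-refl)
                                  nothing X∈ ty Z≤X (All.lookup executed X∈)

    new-stilde-fresh : ∀ {j* kf p X} → j* ∈ W →
                       Loop 𝒳 (λ t → r j* ≤ t × t ≤ τ) 0 nothing kf p →
                       X ∈ 𝒳 → Disjoint (stilde X) (j* ∷ nonCritical p)
    new-stilde-fresh j*∈W loop X∈ (j∈S , here refl) = waiting-∉-stilde j*∈W X∈ j∈S
    new-stilde-fresh {p = just _} j*∈W loop X∈ (j∈S , there j∈nc) =
      nonCritical-∉-stilde j*∈W loop j∈nc X∈ j∈S

  ∈-remove⁻ : ∀ J W {j} → j ∈ remove J W → j ∈ W × j ∉ J
  ∈-remove⁻ J W = ∈-filter⁻ (λ j → ¬? (∈?-with _≟_ j J)) {xs = W}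

  stildeShape-++ : ∀ {𝒳 ys X} → StildeShape 𝒳 X → StildeShape (𝒳 ++ ys) X
  stildeShape-++ (stildeShape p eq pred) =
    stildeShape p eq (Maybe.map (λ (Z∈ , rest) → ∈-++⁺ˡ Z∈ , rest) pred)

  invariant-init : Invariant 0 (released 0) []
  invariant-init = record
    { executed            = []
    ; scheduled-released  = []
    ; waiting-released    = All.tabulate (λ j∈ → ≤-reflexive (∈-released⁻ j∈))
    ; waiting-unscheduled = []
    ; critical-scheduled  = []
    ; jobs-disjoint       = []
    ; stilde-shape        = []
    ; stilde-disjoint     = []
    }

  invariant-advance : ∀ {τ W 𝒳} → Invariant τ W 𝒳 → Invariant (suc τ) (W ++ released (suc τ)) 𝒳
  invariant-advance {τ} {W} inv = record
    { executed            = All.map m≤n⇒m≤1+n executed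
    ; scheduled-released  = All.map (All.map m≤n⇒m≤1+n) scheduled-released
    ; waiting-released    = All.tabulate released-by
    ; waiting-unscheduled = All.zipWith (λ {X} → unscheduled {X}) (waiting-unscheduled , scheduled-released)
    ; critical-scheduled  = critical-scheduled
    ; jobs-disjoint       = jobs-disjoint
    ; stilde-shape        = stilde-shape
    ; stilde-disjoint     = stilde-disjoint
    }
    where
    open Invariant inv
    released-by : ∀ {j} → j ∈ W ++ released (suc τ) → r j ≤ suc τ
    released-by j∈ with ∈-++⁻ W j∈
    ... | inj₁ j∈W   = m≤n⇒m≤1+n (All.lookup waiting-released j∈W)
    ... | inj₂ j∈new = ≤-reflexive (∈-released⁻ j∈new)
    unscheduled : ∀ {X} → Disjoint (jobs X) W × All (λ j → r j ≤ τ) (jobs X) →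
                  Disjoint (jobs X) (W ++ released (suc τ))
    unscheduled (disjoint , on-time) (j∈X , j∈) with ∈-++⁻ W j∈
    ... | inj₁ j∈W   = disjoint (j∈X , j∈W)
    ... | inj₂ j∈new = n≮n τ (subst (_≤ τ) (∈-released⁻ j∈new) (All.lookup on-time j∈X))

  invariant-create : ∀ {τ W 𝒳 k p J} (j* : Fin n) → Invariant τ W 𝒳 → j* ∈ W →
                     Loop 𝒳 (λ t → r j* ≤ t × t ≤ τ) 0 nothing k p → EDF W j* k J →
                     Invariant τ (remove J W) (𝒳 ++ [ mkBatch J k τ j* (j* ∷ nonCritical p) ])
  invariant-create {τ} {W} {𝒳} {k} {p} {J} j* inv j*∈W loop (_ , J⊆W , _ , j*∈J , _) = record
    { executed            = ∷ʳ⁺ executed ≤-refl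
    ; scheduled-released  = ∷ʳ⁺ scheduled-released (All.tabulate (λ j∈J → released-by (J⊆W j∈J)))
    ; waiting-released    = All.tabulate (λ j∈ → released-by (still-waiting j∈))
    ; waiting-unscheduled = ∷ʳ⁺ (All.map (λ disjoint {_} (j∈X , j∈) → disjoint (j∈X , still-waiting j∈))
                                         waiting-unscheduled)
                                (λ {_} (j∈J , j∈) → proj₂ (∈-remove⁻ J W j∈) j∈J)
    ; critical-scheduled  = ∷ʳ⁺ critical-scheduled j*∈J
    ; jobs-disjoint       = disjoint-∷ʳ jobs-disjoint
                              (All.map (λ disjoint {_} (j∈X , j∈J) → disjoint (j∈X , J⊆W j∈J)) waiting-unscheduled)
    ; stilde-shape        = ∷ʳ⁺ (All.map stildeShape-++ stilde-shape) (stildeShape p refl predecessor)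
    ; stilde-disjoint     = disjoint-∷ʳ stilde-disjoint (All.tabulate (new-stilde-fresh inv j*∈W loop))
    }
    where
    open Invariant inv
    released-by : ∀ {j} → j ∈ W → r j ≤ τ
    released-by = All.lookup waiting-released
    still-waiting : ∀ {j} → j ∈ remove J W → j ∈ W
    still-waiting j∈ = proj₁ (∈-remove⁻ J W j∈)
    predecessor : Maybe.All (Predecessor (𝒳 ++ [ mkBatch J k τ j* (j* ∷ nonCritical p) ])
                                         (mkBatch J k τ j* (j* ∷ nonCritical p))) p
    predecessor =
      Maybe.map (λ (Z∈ , k≡) → ∈-++⁺ˡ Z∈ , k≡ , All.lookup executed Z∈) (loop-chosen loop nothing)

  invariant : ∀ {τ W 𝒳} → Reach τ W 𝒳 → Invariant τ W 𝒳
  invariant init                              = invariant-init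
  invariant (advance reach _)                 = invariant-advance (invariant reach)
  invariant (create j* reach j*∈W _ loop edf) = invariant-create j* (invariant reach) j*∈W loop edf

lemma4 : ∀ {n : ℕ} (B : ℕ → ℕ) (r d : Fin n → ℕ) →
         (∀ j → r j ≤ d j) →
         (∀ k → 0 < B k) →
         (∀ k → B k < B (suc k)) →
         ∀ {τ : ℕ} {W : List (Fin n)} {𝒳 : List (Batch n)} →
         Algorithm.Reach B r d τ W 𝒳 →
         ∀ (j : Fin n) (x y : Fin (length 𝒳)) →
         j ∈ stilde (lookup 𝒳 x) → j ∈ stilde (lookup 𝒳 y) → x ≡ y
lemma4 B r d _ _ _ reach _ = disjoint-lookup-unique (Invariant.stilde-disjoint (invariant B r d reach))
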